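{- For any finite simple graph $G$ of order $n$, $\mathrm{MOF}(G) \geq \big \lfloor \frac{\sqrt{n}}{2} \big \rfloor$.
   Context: An orientation $D$ of a simple graph $G$ assigns to each edge exactly one direction; if $(u,v)$ is an arc, $v$ is an out-neighbor of $u$. Oriented $1$-forcing: starting from a nonempty set $S$ of colored vertices, repeatedly, any colored vertex with at most one non-colored out-neighbor forces that out-neighbor to become colored (all forcings in a step simultaneous), until no change occurs; $S$ is a forcing set if all vertices end up colored. $F(D)$ is the minimum size of a forcing set of $D$, and $\mathrm{MOF}(G)$ is the maximum of $F(D)$ over all orientations $D$ of $G$. -}

module Defs where

open import Data.Nat using (ℕ; zero; suc)
open import Data.Bool using (Bool; true; false; _∧_; _∨_; not)
open import Data.Fin using (Fin; zero; suc; _≟_)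
open import Data.Fin.Subset using (Subset; ⊤; ∣_∣; Nonempty)
open import Data.Vec using (lookup; tabulate)
open import Data.Product using (∃; _×_)
open import Relation.Nullary.Decidable using (⌊_⌋)
open import Relation.Binary.PropositionalEquality using (_≡_; _≢_)

record SimpleGraph (n : ℕ) : Set where
  field
    adj     : Fin n → Fin n → Bool
    symm    : ∀ u v → adj u v ≡ adj v u
    irrefl  : ∀ v → adj v v ≡ false

open SimpleGraph public

record Orientation {n : ℕ} (G : SimpleGraph n) : Set where
  field
    arc        : Fin n → Fin n → Bool
    arc⇒adj    : ∀ u v → arc u v ≡ true → adj G u v ≡ true
    exactlyOne : ∀ u v → adj G u v ≡ true → arc u v ≢ arc v u

open Orientation public

anyᵇ : ∀ {n} → (Fin n → Bool) → Bool
anyᵇ {zero}  p = false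
anyᵇ {suc n} p = p zero ∨ anyᵇ (λ i → p (suc i))

allᵇ : ∀ {n} → (Fin n → Bool) → Bool
allᵇ {zero}  p = true
allᵇ {suc n} p = p zero ∧ allᵇ (λ i → p (suc i))

forces : ∀ {n} {G : SimpleGraph n} → Orientation G → Subset n → Fin n → Fin n → Bool
forces D C u v =
  lookup C u ∧ arc D u v ∧
  allᵇ (λ w → not (arc D u w) ∨ lookup C w ∨ ⌊ w ≟ v ⌋)

step : ∀ {n} {G : SimpleGraph n} → Orientation G → Subset n → Subset n
step D C = tabulate (λ v → lookup C v ∨ anyᵇ (λ u → forces D C u v))

iter : ∀ {A : Set} → (A → A) → ℕ → A → A
iter f zero    x = x
iter f (suc k) x = f (iter f k x)

IsForcingSet : ∀ {n} {G : SimpleGraph n} → Orientation G → Subset n → Set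
IsForcingSet {n} D S = Nonempty S × ∃ λ k → iter (step D) k S ≡ ⊤

-- Take a Grundy colouring (a vertex of colour c has neighbours of every colour below c) and
-- orient each edge towards the smaller colour.  The vertices of colours 2i and 2i+1 form a trap:
-- a vertex outside pointing into it has a larger colour, hence points at a second vertex of the
-- pair, so it can never force into an uncoloured pair, and every forcing set must meet the pair.
-- Hence a colour above 2b forces more than b vertices into every forcing set.  Otherwise there
-- are at most 2(b+1) colours, and either some colour class has more than b vertices (orient it
-- as a set of sources, which every forcing set contains) or n ≤ 2(b+1)b < 4(b+1)².

module Submission where

open import Defs
open import Data.Nat using (ℕ; zero; suc; _+_; _*_; _≤_; _<_; _⊔_; z≤n; s≤s; ⌊_/2⌋)
open import Data.Nat.Properties
  using ( ≤-refl; ≤-trans; <-trans; <⇒≤; n≤1+n; 1+n≢n; ≤-reflexive; <-≤-trans; ≤-<-trans; <⇒≢; <⇒≱; <-asym; <-irrefl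
        ; ≮⇒≥; ≤-antisym; ≤∧≢⇒<; n≮0; m<1+n⇒m<n∨m≡n; m≤n⇒m≤1+n; m≤m+n
        ; m≤m⊔n; m≤n⊔m; +-comm; +-suc; +-mono-≤; +-monoʳ-≤; +-cancelˡ-≡
        ; *-monoˡ-≤; *-monoʳ-<; n<1+n; _<?_; _≤?_
        ; ≤-pred; ⌊n/2⌋-mono; ⌊n/2⌋≤⌈n/2⌉; ⌊n/2⌋+⌈n/2⌉≡n; n≡⌊n+n/2⌋; anyUpTo?
        ; module ≤-Reasoning )
  renaming (_≟_ to _≟ℕ_)
open import Data.Bool using (Bool; true; false; _∧_; _∨_; not; if_then_else_; T)
open import Data.Bool.Properties using (T-∧; T-≡; ¬-not) renaming (_≟_ to _≟ᵇ_)
open import Data.Fin using (Fin; zero; suc; toℕ; _≟_)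
open import Data.Fin.Properties using (any?; toℕ-injective; toℕ<n)
open import Data.Fin.Subset using (Subset; ∣_∣)
open import Data.Vec using ([]; _∷_; lookup; tabulate)
open import Data.Vec.Properties using (lookup∘tabulate; lookup-replicate)
open import Data.Product using (∃; _×_; _,_; proj₁; proj₂)
open import Data.Sum using (_⊎_; inj₁; inj₂; [_,_]′)
open import Data.Empty using (⊥-elim)
open import Function using (id; _∘_)
open import Level using (0ℓ)
open import Function.Bundles using (Equivalence)
open import Relation.Nullary using (¬_; Dec; yes; no; contradiction)
open import Relation.Nullary.Decidable using (⌊_⌋; _×-dec_; toWitness; fromWitness; toWitnessFalse; fromWitnessFalse)
open import Relation.Unary using (Pred; Decidable)
open import Relation.Binary.PropositionalEquality using (_≡_; _≢_; refl; sym; trans; cong; subst)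

open Equivalence using (to; from)

∧-≡-true : ∀ {a b} → a ∧ b ≡ true → a ≡ true × b ≡ true
∧-≡-true {true} b≡true = refl , b≡true

T-∧-intro : ∀ {a b} → T a → T b → T (a ∧ b)
T-∧-intro ta tb = from T-∧ (ta , tb)

≢⇒<?-differ : ∀ {x y} → x ≢ y → ⌊ y <? x ⌋ ≢ ⌊ x <? y ⌋
≢⇒<?-differ {x} {y} x≢y with y <? x | x <? y
... | yes y<x | yes x<y = λ _ → <-asym y<x x<y
... | yes _   | no _    = λ ()
... | no _    | yes _   = λ ()
... | no y≮x  | no x≮y  = λ _ → x≢y (≤-antisym (≮⇒≥ y≮x) (≮⇒≥ x≮y))

⌊1+n+n/2⌋≡n : ∀ n → ⌊ suc (n + n) /2⌋ ≡ n
⌊1+n+n/2⌋≡n zero    = refl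
⌊1+n+n/2⌋≡n (suc n) = cong suc (trans (cong ⌊_/2⌋ (+-suc n n)) (⌊1+n+n/2⌋≡n n))

≤⌊n/2⌋⇒m+m≤n : ∀ {m n} → m ≤ ⌊ n /2⌋ → m + m ≤ n
≤⌊n/2⌋⇒m+m≤n {m} {n} m≤⌊n/2⌋ = ≤-trans
  (+-mono-≤ m≤⌊n/2⌋ (≤-trans m≤⌊n/2⌋ (⌊n/2⌋≤⌈n/2⌉ n)))
  (≤-reflexive (⌊n/2⌋+⌈n/2⌉≡n n))

<⌊n/2⌋⇒1+m+m<n : ∀ {m n} → m < ⌊ n /2⌋ → suc (m + m) < n
<⌊n/2⌋⇒1+m+m<n {m} {n} m<⌊n/2⌋ =
  subst (_≤ n) (cong suc (+-suc m m)) (≤⌊n/2⌋⇒m+m≤n m<⌊n/2⌋)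

[k+k]*b<4*k*k : ∀ b → (suc b + suc b) * b < 4 * suc b * suc b
[k+k]*b<4*k*k b = begin-strict
  (k + k) * b  ≤⟨ *-monoˡ-≤ b (+-monoʳ-≤ k (m≤m+n k (k + (k + 0)))) ⟩
  4 * k * b    <⟨ *-monoʳ-< (4 * k) (n<1+n b) ⟩
  4 * k * k    ∎
  where
  open ≤-Reasoning
  k : ℕ
  k = suc b

finite-bounded : ∀ {n} (f : Fin n → ℕ) → ∃ λ m → ∀ i → f i < m
finite-bounded {zero}  f = 0 , λ ()
finite-bounded {suc n} f with finite-bounded (f ∘ suc)
... | m , f∘suc<m = suc (f zero) ⊔ m , bounded
  where
  bounded : ∀ i → f i < suc (f zero) ⊔ m
  bounded zero    = m≤m⊔n (suc (f zero)) m
  bounded (suc i) = <-≤-trans (f∘suc<m i) (m≤n⊔m (suc (f zero)) m)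

minimal-counterexample : ∀ {p} {P : Pred ℕ p} → Decidable P → ∀ b → ¬ P b →
  ∃ λ c → ¬ P c × (∀ {i} → i < c → P i)
minimal-counterexample {P = P} P? b ¬Pb =
  [ (λ below → contradiction (below ≤-refl) ¬Pb) , id ]′ (search (suc b))
  where
  search : ∀ m → (∀ {i} → i < m → P i) ⊎ ∃ λ c → ¬ P c × (∀ {i} → i < c → P i)
  search zero = inj₁ λ ()
  search (suc m) with search m
  ... | inj₂ found = inj₂ found
  ... | inj₁ below with P? m
  ...   | no ¬Pm = inj₂ (m , ¬Pm , below)
  ...   | yes Pm = inj₁ λ i<1+m → [ below , (λ { refl → Pm }) ]′ (m<1+n⇒m<n∨m≡n i<1+m)

anyᵇ-witness : ∀ {n} (p : Fin n → Bool) → anyᵇ p ≡ true → ∃ λ i → p i ≡ true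
anyᵇ-witness {suc n} p any≡true with p zero in p0≡true
... | true  = zero , p0≡true
... | false with anyᵇ-witness (p ∘ suc) any≡true
...   | i , pi≡true = suc i , pi≡true

allᵇ-elim : ∀ {n} (p : Fin n → Bool) → allᵇ p ≡ true → ∀ i → p i ≡ true
allᵇ-elim p all≡true zero    = proj₁ (∧-≡-true all≡true)
allᵇ-elim p all≡true (suc i) = allᵇ-elim (p ∘ suc) (proj₂ (∧-≡-true {p zero} all≡true)) i

count : ∀ {n} → (Fin n → Bool) → ℕ
count {zero}  p = 0
count {suc n} p = (if p zero then 1 else 0) + count (p ∘ suc)

∣S∣≡count : ∀ {n} (S : Subset n) → ∣ S ∣ ≡ count (lookup S)
∣S∣≡count []          = refl
∣S∣≡count (true ∷ S)  = cong suc (∣S∣≡count S)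
∣S∣≡count (false ∷ S) = ∣S∣≡count S

count-true : ∀ n → count {n} (λ _ → true) ≡ n
count-true zero    = refl
count-true (suc n) = cong suc (count-true n)

count-none : ∀ {n} (p : Fin n → Bool) → (∀ i → ¬ T (p i)) → count p ≡ 0
count-none {zero}  p none = refl
count-none {suc n} p none with p zero in p0≡
... | true  = contradiction (from T-≡ p0≡) (none zero)
... | false = count-none (p ∘ suc) (none ∘ suc)

count-pos : ∀ {n} (p : Fin n → Bool) i → T (p i) → 1 ≤ count p
count-pos p zero    pi with p zero
... | true = s≤s z≤n
count-pos p (suc i) pi with p zero
... | true  = s≤s z≤n
... | false = count-pos (p ∘ suc) i pi

count-mono : ∀ {n} (p q : Fin n → Bool) → (∀ i → T (p i) → T (q i)) → count p ≤ count q
count-mono {zero}  p q p⊆q = z≤n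
count-mono {suc n} p q p⊆q with p zero | q zero | p⊆q zero
... | true  | true  | _    = s≤s (count-mono (p ∘ suc) (q ∘ suc) (p⊆q ∘ suc))
... | true  | false | p0⇒q0 = ⊥-elim (p0⇒q0 _)
... | false | true  | _    = m≤n⇒m≤1+n (count-mono (p ∘ suc) (q ∘ suc) (p⊆q ∘ suc))
... | false | false | _    = count-mono (p ∘ suc) (q ∘ suc) (p⊆q ∘ suc)

count-split : ∀ {n} (p q : Fin n → Bool) →
  count p ≡ count (λ i → p i ∧ q i) + count (λ i → p i ∧ not (q i))
count-split {zero}  p q = refl
count-split {suc n} p q with p zero | q zero
... | true  | true  = cong suc (count-split (p ∘ suc) (q ∘ suc))
... | true  | false = trans (cong suc (count-split (p ∘ suc) (q ∘ suc))) (sym (+-suc _ _))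
... | false | true  = count-split (p ∘ suc) (q ∘ suc)
... | false | false = count-split (p ∘ suc) (q ∘ suc)

fibre : ∀ {n} → (Fin n → ℕ) → ℕ → Fin n → Bool
fibre g c v = ⌊ g v ≟ℕ c ⌋

count-≥-meets-fibres : ∀ {n} (p : Fin n → Bool) (g : Fin n → ℕ) k →
  (∀ {i} → i < k → ∃ λ v → T (p v) × g v ≡ i) → k ≤ count p
count-≥-meets-fibres p g zero    meets = z≤n
count-≥-meets-fibres {n} p g (suc k) meets with meets ≤-refl
... | v , pv , gv≡k = begin
  suc k                         ≡⟨ +-comm 1 k ⟩
  k + 1                         ≤⟨ +-mono-≤ (count-≥-meets-fibres outside g k meetsOutside)
                                            (count-pos inside v (T-∧-intro pv (fromWitness gv≡k))) ⟩
  count outside + count inside  ≡⟨ +-comm (count outside) (count inside) ⟩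
  count inside + count outside  ≡⟨ count-split p (fibre g k) ⟨
  count p                       ∎
  where
  open ≤-Reasoning
  inside outside : Fin n → Bool
  inside  v = p v ∧ fibre g k v
  outside v = p v ∧ not (fibre g k v)
  meetsOutside : ∀ {i} → i < k → ∃ λ v → T (outside v) × g v ≡ i
  meetsOutside i<k with meets (m≤n⇒m≤1+n i<k)
  ... | w , pw , refl = w , T-∧-intro pw (fromWitnessFalse (<⇒≢ i<k)) , refl

count-≤-by-fibres : ∀ {n} (p : Fin n → Bool) (g : Fin n → ℕ) j b →
  (∀ {c} → c < j → count (fibre g c) ≤ b) → (∀ v → T (p v) → g v < j) → count p ≤ j * b
count-≤-by-fibres p g zero    b small below =
  ≤-reflexive (count-none p λ v pv → n≮0 (below v pv))
count-≤-by-fibres {n} p g (suc j) b small below = begin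
  count p                                       ≡⟨ count-split p (fibre g j) ⟩
  count (λ v → p v ∧ fibre g j v) + count rest  ≤⟨ +-mono-≤ inFibre restBound ⟩
  b + j * b                                     ∎
  where
  open ≤-Reasoning
  rest : Fin n → Bool
  rest v = p v ∧ not (fibre g j v)
  inFibre : count (λ v → p v ∧ fibre g j v) ≤ b
  inFibre = ≤-trans (count-mono _ (fibre g j) (λ v → proj₂ ∘ to T-∧)) (small ≤-refl)
  restBound : count rest ≤ j * b
  restBound = count-≤-by-fibres rest g j b (small ∘ m≤n⇒m≤1+n) λ v rv →
    let pv , gv≢j = to T-∧ rv in ≤∧≢⇒< (≤-pred (below v pv)) (toWitnessFalse gv≢j)

module _ {n} {G : SimpleGraph n} (D : Orientation G) where

  -- A vertex pointing into an uncoloured trap is outside it with two uncoloured out-neighbours.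
  IsTrap : Pred (Fin n) 0ℓ → Set
  IsTrap B = ∀ {u v} → B v → arc D u v ≡ true →
    B u ⊎ ∃ λ w → B w × w ≢ v × arc D u w ≡ true

  Avoids : Pred (Fin n) 0ℓ → Subset n → Set
  Avoids B C = ∀ {v} → B v → lookup C v ≡ false

  trap-blocks-forcing : ∀ {B C u v} → IsTrap B → Avoids B C → B v → forces D C u v ≢ true
  trap-blocks-forcing {B} {C} {u} {v} trap avoids Bv forcing
    with ∧-≡-true forcing
  ... | Cu , rest with ∧-≡-true rest
  ... | uv , others with trap Bv uv
  ... | inj₁ Bu = contradiction (trans (sym Cu) (avoids Bu)) λ ()
  ... | inj₂ (w , Bw , w≢v , uw)
    with allᵇ-elim _ others w
  ... | w-done rewrite uw | avoids Bw with w ≟ v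
  ...   | yes w≡v = w≢v w≡v
  ...   | no _    = contradiction w-done λ ()

  step-avoids : ∀ {B C} → IsTrap B → Avoids B C → Avoids B (step D C)
  step-avoids {B} {C} trap avoids {v} Bv
    rewrite lookup∘tabulate (λ v → lookup C v ∨ anyᵇ (λ u → forces D C u v)) v
          | avoids Bv
    = ¬-not λ anyForces →
        let u , forcing = anyᵇ-witness (λ u → forces D C u v) anyForces in
        trap-blocks-forcing {C = C} {u} trap avoids Bv forcing

  forcingSet-meets-trap : ∀ {B} → Decidable B → IsTrap B → ∀ {x} → B x →
    ∀ {S} → IsForcingSet D S → ∃ λ v → B v × lookup S v ≡ true
  forcingSet-meets-trap {B} B? trap {x} Bx {S} (_ , k , colours-all)
    with any? (λ v → B? v ×-dec (lookup S v ≟ᵇ true))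
  ... | yes meets = meets
  ... | no misses = contradiction x-coloured λ ()
    where
    avoidsForever : ∀ k → Avoids B (iter (step D) k S)
    avoidsForever zero    Bv = ¬-not λ Sv → misses (_ , Bv , Sv)
    avoidsForever (suc k) = step-avoids {C = iter (step D) k S} trap (avoidsForever k)
    x-coloured : true ≡ false
    x-coloured = trans (sym (lookup-replicate x true))
      (subst (λ C → lookup C x ≡ false) colours-all (avoidsForever k Bx))

  source-in-forcingSet : ∀ {v} → (∀ u → arc D u v ≢ true) →
    ∀ {S} → IsForcingSet D S → lookup S v ≡ true
  source-in-forcingSet {v} source {S} forcingSet
    with forcingSet-meets-trap (_≟ v) (λ { refl uv → contradiction uv (source _) }) refl {S} forcingSet
  ... | _ , refl , Sv = Sv

module _ {n} (G : SimpleGraph n) where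

  adj⇒≢ : ∀ {u v} → adj G u v ≡ true → u ≢ v
  adj⇒≢ {u} uv refl = contradiction (trans (sym uv) (irrefl G u)) λ ()

  downwardOrientation : (r : Fin n → ℕ) → (∀ {u v} → adj G u v ≡ true → r u ≢ r v) → Orientation G
  downwardOrientation r r-proper = record
    { arc        = λ u v → adj G u v ∧ ⌊ r v <? r u ⌋
    ; arc⇒adj    = λ u v → proj₁ ∘ ∧-≡-true
    ; exactlyOne = exactlyOne′
    }
    where
    exactlyOne′ : ∀ u v → adj G u v ≡ true → adj G u v ∧ ⌊ r v <? r u ⌋ ≢ adj G v u ∧ ⌊ r u <? r v ⌋
    exactlyOne′ u v uv rewrite uv | symm G v u | uv = ≢⇒<?-differ (r-proper uv)

  downward-arc⇒< : ∀ {r} {r-proper : ∀ {u v} → adj G u v ≡ true → r u ≢ r v} {u v} →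
    arc (downwardOrientation r r-proper) u v ≡ true → r v < r u
  downward-arc⇒< {u = u} {v} uv = toWitness (from T-≡ (proj₂ (∧-≡-true {adj G u v} uv)))

  downward-arc⁺ : ∀ {r} {r-proper : ∀ {u v} → adj G u v ≡ true → r u ≢ r v} {u v} →
    adj G u v ≡ true → r v < r u → arc (downwardOrientation r r-proper) u v ≡ true
  downward-arc⁺ uv v<u rewrite uv = to T-≡ (fromWitness v<u)

  module _ (I : Fin n → Bool) (independent : ∀ {u v} → T (I u) → T (I v) → adj G u v ≢ true) where

    -- Vertices of I get the top ranks, so the downward orientation makes them sources.
    rank : Fin n → ℕ
    rank u = if I u then n + toℕ u else toℕ u

    rank-injective : ∀ {u v} → rank u ≡ rank v → u ≡ v
    rank-injective {u} {v} with I u | I v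
    ... | true  | true  = toℕ-injective ∘ +-cancelˡ-≡ n (toℕ u) (toℕ v)
    ... | false | false = toℕ-injective
    ... | true  | false = λ e →
      contradiction (≤-trans (m≤m+n n (toℕ u)) (≤-reflexive e)) (<⇒≱ (toℕ<n v))
    ... | false | true  = λ e →
      contradiction (≤-trans (m≤m+n n (toℕ v)) (≤-reflexive (sym e))) (<⇒≱ (toℕ<n u))

    rank-above-I : ∀ {u v} → T (I v) → rank v < rank u → T (I u)
    rank-above-I {u} {v} Iv v<u with I u | I v
    ... | true  | _    = _
    ... | false | true =
      ⊥-elim (<-irrefl refl (≤-<-trans (m≤m+n n (toℕ v)) (<-trans v<u (toℕ<n u))))

    independentSet-bound : ∃ λ (D : Orientation G) → (S : Subset n) → IsForcingSet D S → count I ≤ ∣ S ∣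
    independentSet-bound = D , λ S forcingSet → begin
      count I          ≤⟨ count-mono I (lookup S) (λ v Iv → from T-≡ (I⊆S forcingSet Iv)) ⟩
      count (lookup S) ≡⟨ ∣S∣≡count S ⟨
      ∣ S ∣            ∎
      where
      open ≤-Reasoning
      rank-proper : ∀ {u v} → adj G u v ≡ true → rank u ≢ rank v
      rank-proper uv = adj⇒≢ uv ∘ rank-injective
      D : Orientation G
      D = downwardOrientation rank rank-proper
      isSource : ∀ {v} → T (I v) → ∀ u → arc D u v ≢ true
      isSource Iv u uv =
        independent (rank-above-I Iv (downward-arc⇒< {r-proper = rank-proper} uv)) Iv (arc⇒adj D u _ uv)
      I⊆S : ∀ {S} → IsForcingSet D S → ∀ {v} → T (I v) → lookup S v ≡ true
      I⊆S forcingSet Iv = source-in-forcingSet D (isSource Iv) forcingSet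

record GrundyColouring {n} (G : SimpleGraph n) : Set where
  field
    colour : Fin n → ℕ
    proper : ∀ {u v} → adj G u v ≡ true → colour u ≢ colour v
    grundy : ∀ v {c} → c < colour v → ∃ λ w → adj G v w ≡ true × colour w ≡ c

dropFirst : ∀ {n} → SimpleGraph (suc n) → SimpleGraph n
dropFirst G = record
  { adj    = λ u v → adj G (suc u) (suc v)
  ; symm   = λ u v → symm G (suc u) (suc v)
  ; irrefl = λ v → irrefl G (suc v)
  }

-- First fit: vertex 0 takes the least colour not used on its neighbourhood.
extendGrundy : ∀ {n} (G : SimpleGraph (suc n)) → GrundyColouring (dropFirst G) → GrundyColouring G
extendGrundy {n} G χ = record { colour = colour ; proper = proper ; grundy = grundy }
  where
  open GrundyColouring χ renaming (colour to colour′; proper to proper′; grundy to grundy′)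

  UsedAtZero : Pred ℕ 0ℓ
  UsedAtZero c = ∃ λ w → adj G zero (suc w) ≡ true × colour′ w ≡ c

  firstFree : ∃ λ c → ¬ UsedAtZero c × (∀ {i} → i < c → UsedAtZero i)
  firstFree with finite-bounded colour′
  ... | m , colour′<m =
    minimal-counterexample (λ c → any? λ w → (adj G zero (suc w) ≟ᵇ true) ×-dec (colour′ w ≟ℕ c)) m
      λ { (w , _ , refl) → <-irrefl refl (colour′<m w) }

  colour : Fin (suc n) → ℕ
  colour zero    = proj₁ firstFree
  colour (suc w) = colour′ w

  free : ∀ {w} → adj G zero (suc w) ≡ true → colour zero ≢ colour′ w
  free zw c≡ = proj₁ (proj₂ firstFree) (_ , zw , sym c≡)

  proper : ∀ {u v} → adj G u v ≡ true → colour u ≢ colour v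
  proper {zero}  {zero}  uv = contradiction (trans (sym uv) (irrefl G zero)) λ ()
  proper {zero}  {suc w} uv = free uv
  proper {suc w} {zero}  uv = free (trans (symm G zero (suc w)) uv) ∘ sym
  proper {suc u} {suc v} uv = proper′ uv

  grundy : ∀ v {c} → c < colour v → ∃ λ w → adj G v w ≡ true × colour w ≡ c
  grundy zero    c<colour with proj₂ (proj₂ firstFree) c<colour
  ... | w , zw , refl = suc w , zw , refl
  grundy (suc v) c<colour with grundy′ v c<colour
  ... | w , vw , refl = suc w , vw , refl

grundyColouring : ∀ {n} (G : SimpleGraph n) → GrundyColouring G
grundyColouring {zero}  G = record { colour = λ () ; proper = λ { {()} } ; grundy = λ () }
grundyColouring {suc n} G = extendGrundy G (grundyColouring (dropFirst G))

module _ {n} {G : SimpleGraph n} (χ : GrundyColouring G) where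
  open GrundyColouring χ

  grundyOrientation : Orientation G
  grundyOrientation = downwardOrientation G colour proper

  colourClass-independent : ∀ c {u v} → T (fibre colour c u) → T (fibre colour c v) → adj G u v ≢ true
  colourClass-independent c cu cv uv = proper uv (trans (toWitness cu) (sym (toWitness cv)))

  layer : Fin n → ℕ
  layer v = ⌊ colour v /2⌋

  -- Layer i holds the colours 2i and 2i+1; a vertex above it sees both, so it sees one avoiding x.
  neighbour-in-layer : ∀ {u} i → i < layer u → ∀ x →
    ∃ λ w → adj G u w ≡ true × colour w < colour u × layer w ≡ i × colour w ≢ x
  neighbour-in-layer {u} i i<layer-u x = avoiding (x ≟ℕ i + i)
    where
    Goal : Set
    Goal = ∃ λ w → adj G u w ≡ true × colour w < colour u × layer w ≡ i × colour w ≢ x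
    top : suc (i + i) < colour u
    top = <⌊n/2⌋⇒1+m+m<n i<layer-u
    pick : ∀ c → c ≤ suc (i + i) → ⌊ c /2⌋ ≡ i → c ≢ x → Goal
    pick c c≤ half c≢x with grundy u (≤-<-trans c≤ top)
    ... | w , uw , refl = w , uw , ≤-<-trans c≤ top , half , c≢x
    avoiding : Dec (x ≡ i + i) → Goal
    avoiding (yes x≡2i) = pick (suc (i + i)) ≤-refl (⌊1+n+n/2⌋≡n i) (λ e → 1+n≢n (trans e x≡2i))
    avoiding (no x≢2i)  = pick (i + i) (n≤1+n (i + i)) (sym (n≡⌊n+n/2⌋ i)) (x≢2i ∘ sym)

  layer-trap : ∀ i → IsTrap grundyOrientation (λ v → layer v ≡ i)
  layer-trap i {u} {v} refl uv with layer u ≟ℕ layer v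
  ... | yes same = inj₁ same
  ... | no differ with neighbour-in-layer (layer v) above (colour v)
    where
    above : layer v < layer u
    above = ≤∧≢⇒< (⌊n/2⌋-mono (<⇒≤ (downward-arc⇒< G {r-proper = proper} uv))) (differ ∘ sym)
  ...   | w , uw , w<u , lw , w≢v = inj₂ (w , lw , w≢v ∘ cong colour , downward-arc⁺ G {r-proper = proper} uw w<u)

  grundy-bound : ∀ {b t} → b + b < colour t → (S : Subset n) → IsForcingSet grundyOrientation S → suc b ≤ ∣ S ∣
  grundy-bound {b} {t} high S forcingSet =
    subst (suc b ≤_) (sym (∣S∣≡count S)) (count-≥-meets-fibres (lookup S) layer (suc b) meets)
    where
    meets : ∀ {i} → i < suc b → ∃ λ v → T (lookup S v) × layer v ≡ i
    meets {i} i≤b with grundy t (≤-<-trans (+-mono-≤ (≤-pred i≤b) (≤-pred i≤b)) high)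
    ... | x , _ , x≡2i
      with forcingSet-meets-trap grundyOrientation (λ v → layer v ≟ℕ i) (layer-trap i)
             (trans (cong ⌊_/2⌋ x≡2i) (sym (n≡⌊n+n/2⌋ i))) forcingSet
    ... | v , lv , Sv = v , from T-≡ Sv , lv

  few-vertices : ∀ b → (∀ t → colour t ≤ b + b) → (∀ {c} → c < suc b + suc b → count (fibre colour c) ≤ b) →
    n ≤ (suc b + suc b) * b
  few-vertices b low small = begin
    n                      ≡⟨ count-true n ⟨
    count {n} (λ _ → true) ≤⟨ count-≤-by-fibres (λ _ → true) colour (suc b + suc b) b small below ⟩
    (suc b + suc b) * b    ∎
    where
    open ≤-Reasoning
    below : ∀ t → T true → colour t < suc b + suc b
    below t _ = s≤s (≤-trans (low t) (+-monoʳ-≤ b (n≤1+n b)))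

  forcing-number-bound : ∀ b → 4 * suc b * suc b ≤ n →
    ∃ λ (D : Orientation G) → (S : Subset n) → IsForcingSet D S → suc b ≤ ∣ S ∣
  forcing-number-bound b 4k²≤n with any? (λ t → b + b <? colour t)
  ... | yes (t , high) = grundyOrientation , grundy-bound high
  ... | no noneHigh with anyUpTo? (λ c → suc b ≤? count (fibre colour c)) (suc b + suc b)
  ...   | yes (c , _ , big) with independentSet-bound G (fibre colour c) (colourClass-independent c)
  ...     | D , bound = D , λ S forcingSet → ≤-trans big (bound S forcingSet)
  forcing-number-bound b 4k²≤n | no noneHigh | no noneBig =
    contradiction (≤-trans 4k²≤n (few-vertices b low small)) (<⇒≱ ([k+k]*b<4*k*k b))
    where
    low : ∀ t → colour t ≤ b + b
    low t = ≮⇒≥ λ high → noneHigh (t , high)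
    small : ∀ {c} → c < suc b + suc b → count (fibre colour c) ≤ b
    small c<2k = ≮⇒≥ λ big → noneBig (_ , c<2k , big)

proposition3p18 : (n : ℕ) (G : SimpleGraph n) (k : ℕ) → 4 * k * k ≤ n →
    ∃ λ (D : Orientation G) → (S : Subset n) → IsForcingSet D S → k ≤ ∣ S ∣
proposition3p18 n G zero    _ = grundyOrientation (grundyColouring G) , λ _ _ → z≤n
proposition3p18 n G (suc b)   = forcing-number-bound (grundyColouring G) b
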